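{- Let $k,m\in\mathbb{N}$ with $k\ge2$. (a) For every $\eta\in V(k,m)$, $Ir(\{\eta\})$ is a subsemigroup of $(V(k,m),+)$. (b) The family $\{Ir(\{\eta\}):\eta\in V(k,m)\}$ has the finite intersection property. (c) For every finite subset $\{\eta_1,\ldots,\eta_n\}$ of $V(k,m)$, $Ir(\{\eta_1,\ldots,\eta_n\})=\bigcap_{i=1}^n Ir(\{\eta_i\})$ is a subsemigroup of $(V(k,m),+)$.
   Context: For $t=1,\ldots,k$ there are symbols $1_{t1},\ldots,1_{tm}$; for $j\in\{0,\ldots,m\}$ and $a=(a_1,\ldots,a_m)\in\mathbb{Z}^m$, $a\bullet1_{A_{tj}}$ denotes the string $(a_11_{t1})\cdots(a_j1_{tj})$ (empty if $j=0$). $\Gamma(k,m)$ is the set of strings $x=(a_01_0)(a_1\bullet1_{A_{1j_1}})\cdots(a_k\bullet1_{A_{kj_k}})$ with $a_0\in\mathbb{Z}$, $a_t\in\mathbb{Z}^m$, $j_t\in\{0,\ldots,m\}$; such a string is determined by $a_0$, $(j_1,\ldots,j_k)$ and the first $j_t$ coordinates of each $a_t$. Put $\iota(x)=a_0$, $l(x)=(j_1,\ldots,j_k)$. Strings are compatible if they have the same $\iota$ and $l$, irreducible otherwise; a finite set of strings is irreducible if its elements are pairwise irreducible. The sum of compatible strings adds the vectors $a_t$ componentwise and keeps $a_0$. $V(k,m)$ consists of formal sums $\gamma=x_1+\cdots+x_n$ ($n\ge1$) with $\{x_1,\ldots,x_n\}\subseteq\Gamma(k,m)$ irreducible, identified when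 they have the same set of terms $\mathrm{Term}(\gamma)$. Addition: $\mathrm{Term}(\gamma+\mu)$ consists of the terms of $\gamma$ compatible with no term of $\mu$, the terms of $\mu$ compatible with no term of $\gamma$, and $a+b$ for each compatible pair $(a,b)\in\mathrm{Term}(\gamma)\times\mathrm{Term}(\mu)$. For $\eta\in V(k,m)$, $Ir(\{\eta\})=\{y\in V(k,m):\mathrm{Term}(y)\cup\mathrm{Term}(\eta)\text{ is an irreducible subset of }\Gamma(k,m)\}$. -}

module Defs where

open import Data.Nat using (ℕ; _≤_)
import Data.Nat as ℕ
open import Data.Integer using (ℤ)
import Data.Integer as ℤ
open import Data.List using (List; []; _∷_; _++_; filter; concatMap; length)
import Data.List as List
open import Data.List.Relation.Unary.All using (All)
open import Data.List.Relation.Unary.Any using (Any; any?)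
open import Data.List.Membership.Propositional using (_∈_)
open import Data.Vec using (Vec)
open import Data.Fin using (Fin)
import Data.Vec as Vec
import Data.Vec.Properties as VecP
import Data.Vec.Relation.Unary.All as VAll
open import Data.Product using (_×_; _,_; proj₁; proj₂; Σ)
open import Relation.Binary.PropositionalEquality using (_≡_; _≢_)
open import Relation.Nullary using (¬_; Dec)
open import Relation.Nullary.Decidable using (_×-dec_; ¬?)

-- A string x = (a₀1₀)(a₁•1_{A_{1j₁}})⋯(a_k•1_{A_{kj_k}}) of Γ(k,m) is determined by
-- a₀ ∈ ℤ and, for each t, the list of the first j_t coordinates of a_t
-- (a list of integers of length j_t ≤ m).
Str : ℕ → Set
Str k = ℤ × Vec (List ℤ) k

InΓ : (k m : ℕ) → Str k → Set
InΓ k m x = VAll.All (λ w → length w ≤ m) (proj₂ x)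

ι : ∀ {k} → Str k → ℤ
ι = proj₁

l : ∀ {k} → Str k → Vec ℕ k
l x = Vec.map length (proj₂ x)

Compatible : ∀ {k} → Str k → Str k → Set
Compatible x y = (ι x ≡ ι y) × (l x ≡ l y)

compatible? : ∀ {k} (x y : Str k) → Dec (Compatible x y)
compatible? x y = (ι x ℤ.≟ ι y) ×-dec VecP.≡-dec ℕ._≟_ (l x) (l y)

IrreducibleSet : ∀ {k} → List (Str k) → Set
IrreducibleSet xs = ∀ {x y} → x ∈ xs → y ∈ xs → x ≢ y → ¬ Compatible x y

_+ₛ_ : ∀ {k} → Str k → Str k → Str k
(a₀ , ws) +ₛ (_ , vs) = a₀ , Vec.zipWith (List.zipWith ℤ._+_) ws vs

-- V(k,m): nonempty finite irreducible sets of strings of Γ(k,m);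
-- formal sums are identified with their set of terms (see _≈V_).
record V (k m : ℕ) : Set where
  field
    terms     : List (Str k)
    nonempty  : terms ≢ []
    inΓ       : All (InΓ k m) terms
    irreducible : IrreducibleSet terms
open V public

_≈V_ : ∀ {k m} → V k m → V k m → Set
γ ≈V μ = ∀ x → (x ∈ terms γ → x ∈ terms μ) × (x ∈ terms μ → x ∈ terms γ)

sumTerms : ∀ {k} → List (Str k) → List (Str k) → List (Str k)
sumTerms γ μ =
     filter (λ x → ¬? (any? (compatible? x) μ)) γ
  ++ filter (λ y → ¬? (any? (λ x → compatible? x y) γ)) μ
  ++ concatMap (λ x → List.map (x +ₛ_) (filter (compatible? x) μ)) γ

-- "y ∈ Ir({η})" at the level of term sets: Term(y) ∪ Term(η) is irreducible,
-- read as: the terms of y are pairwise irreducible, and every term of y is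
-- irreducible with (i.e. not compatible with) every term of η
IrT : ∀ {k m} → V k m → List (Str k) → Set
IrT η ys = IrreducibleSet ys ×
           (∀ {x z} → x ∈ ys → z ∈ terms η → ¬ Compatible x z)

Ir : ∀ {k m} → V k m → V k m → Set
Ir η y = IrT η (terms y)

IrSetT : ∀ {k m n} → (Fin n → V k m) → List (Str k) → Set
IrSetT ηs ys = ∀ i → IrT (ηs i) ys

IsSubsemigroup : (k m : ℕ) → (List (Str k) → Set) → Set
IsSubsemigroup k m P =
  Σ (V k m) (λ γ → P (terms γ)) ×
  (∀ (γ μ : V k m) → P (terms γ) → P (terms μ) → P (sumTerms (terms γ) (terms μ)))

-- A sum of two elements of Ir({η}) has three kinds of terms: unmatched terms of either
-- summand, and sums x + y of compatible pairs. Adding compatible strings changes neither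
-- ι nor l, so every term of the sum is compatible with a term of a summand; this
-- transports both pairwise irreducibility and irreducibility with Term(η) to the sum.
-- Nonemptiness and the finite intersection property come from a one-term sum whose
-- ι exceeds |ι| of every term of η₁,…,ηₙ.
module Submission where

open import Defs
open import Data.Nat using (ℕ; zero; suc; _≤_; _⊓_; z≤n; s≤s)
open import Data.Nat.Properties using (m≤m+n; m≤n+m; ≤-trans; <-irrefl; ⊓-idem)
open import Data.Nat.ListAction using (sum)
open import Data.Integer using (ℤ; +_; ∣_∣)
import Data.Integer as ℤ
open import Data.Fin using (Fin)
open import Data.List using (List; []; _∷_; length; map; concatMap; allFin)
import Data.List as List
open import Data.List.Properties using (length-zipWith)
import Data.List.Relation.Unary.All as All
open import Data.List.Relation.Unary.All.Properties using (¬Any⇒All¬)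
open import Data.List.Relation.Unary.Any using (here; there; any?)
open import Data.List.Membership.Propositional using (_∈_; find; lose)
open import Data.List.Membership.Propositional.Properties
  using (∈-++⁻; ∈-filter⁻; ∈-concatMap⁺; ∈-concatMap⁻; ∈-map⁻; ∈-allFin)
open import Data.Vec using (Vec; []; _∷_; replicate; zipWith)
import Data.Vec as Vec
open import Data.Vec.Properties using (∷-injective)
import Data.Vec.Relation.Unary.All as VAll
open import Data.Product using (_×_; _,_; Σ)
open import Data.Sum using (inj₁; inj₂)
open import Relation.Nullary using (¬_)
open import Relation.Nullary.Decidable using (¬?)
open import Relation.Binary.PropositionalEquality

private
  variable
    k : ℕ

Incompatible : List (Str k) → List (Str k) → Set
Incompatible xs zs = ∀ {x z} → x ∈ xs → z ∈ zs → ¬ Compatible x z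

compatible-sym : {x y : Str k} → Compatible x y → Compatible y x
compatible-sym (e , f) = sym e , sym f

compatible-trans : {x y z : Str k} → Compatible x y → Compatible y z → Compatible x z
compatible-trans (e , f) (e′ , f′) = trans e e′ , trans f f′

map-length-zipWith : (ws vs : Vec (List ℤ) k) → Vec.map length ws ≡ Vec.map length vs →
  Vec.map length (zipWith (List.zipWith ℤ._+_) ws vs) ≡ Vec.map length ws
map-length-zipWith [] [] _ = refl
map-length-zipWith (w ∷ ws) (v ∷ vs) e with ∷-injective e
... | ew , ews = cong₂ _∷_ length-w+v (map-length-zipWith ws vs ews)
  where
    open ≡-Reasoning
    length-w+v : length (List.zipWith ℤ._+_ w v) ≡ length w
    length-w+v = begin
      length (List.zipWith ℤ._+_ w v) ≡⟨ length-zipWith ℤ._+_ w v ⟩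
      length w ⊓ length v             ≡⟨ cong (length w ⊓_) ew ⟨
      length w ⊓ length w             ≡⟨ ⊓-idem (length w) ⟩
      length w                        ∎

+ₛ-compatibleˡ : {x y : Str k} → Compatible x y → Compatible (x +ₛ y) x
+ₛ-compatibleˡ {x = _ , ws} {y = _ , vs} (_ , e) = refl , map-length-zipWith ws vs e

+ₛ-compatible⇒compatibleˡ : {x y x′ y′ : Str k} → Compatible x y → Compatible x′ y′ →
  Compatible (x +ₛ y) (x′ +ₛ y′) → Compatible x x′
+ₛ-compatible⇒compatibleˡ c c′ d =
  compatible-trans (compatible-sym (+ₛ-compatibleˡ c)) (compatible-trans d (+ₛ-compatibleˡ c′))

data SumTerm (γ μ : List (Str k)) : Str k → Set where
  onlyˡ : ∀ {x} → x ∈ γ → (∀ {y} → y ∈ μ → ¬ Compatible x y) → SumTerm γ μ x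
  onlyʳ : ∀ {y} → y ∈ μ → (∀ {x} → x ∈ γ → ¬ Compatible x y) → SumTerm γ μ y
  both  : ∀ {x y} → x ∈ γ → y ∈ μ → Compatible x y → SumTerm γ μ (x +ₛ y)

∈-sumTerms⁻ : (γ μ : List (Str k)) {u : Str k} → u ∈ sumTerms γ μ → SumTerm γ μ u
∈-sumTerms⁻ γ μ u∈ with ∈-++⁻ (List.filter _ γ) u∈
... | inj₁ u∈ˡ with ∈-filter⁻ (λ x → ¬? (any? (compatible? x) μ)) {xs = γ} u∈ˡ
...   | x∈ , ¬c = onlyˡ x∈ (All.lookup (¬Any⇒All¬ μ ¬c))
∈-sumTerms⁻ γ μ u∈ | inj₂ u∈′ with ∈-++⁻ (List.filter _ μ) u∈′
... | inj₁ u∈ʳ with ∈-filter⁻ (λ y → ¬? (any? (λ x → compatible? x y) γ)) {xs = μ} u∈ʳ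
...   | y∈ , ¬c = onlyʳ y∈ (All.lookup (¬Any⇒All¬ γ ¬c))
∈-sumTerms⁻ γ μ u∈ | inj₂ u∈′ | inj₂ u∈ˢ
  with find (∈-concatMap⁻ (λ x → map (x +ₛ_) (List.filter (compatible? x) μ)) {xs = γ} u∈ˢ)
... | x , x∈ , u∈x+μ with ∈-map⁻ (x +ₛ_) u∈x+μ
...   | y , y∈ , refl with ∈-filter⁻ (compatible? x) {xs = μ} y∈
...     | y∈μ , c = both x∈ y∈μ c

sumTerms-irreducible : (γ μ : List (Str k)) → IrreducibleSet γ → IrreducibleSet μ →
  IrreducibleSet (sumTerms γ μ)
sumTerms-irreducible γ μ irrγ irrμ u∈ v∈ u≢v c
  with ∈-sumTerms⁻ γ μ u∈ | ∈-sumTerms⁻ γ μ v∈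
... | onlyˡ x∈ _  | onlyˡ x′∈ _ = irrγ x∈ x′∈ u≢v c
... | onlyˡ _ ¬c  | onlyʳ y∈ _  = ¬c y∈ c
... | onlyˡ _ ¬c  | both _ y∈ d = ¬c y∈ (compatible-trans c (compatible-trans (+ₛ-compatibleˡ d) d))
... | onlyʳ y∈ _  | onlyˡ _ ¬c  = ¬c y∈ (compatible-sym c)
... | onlyʳ y∈ _  | onlyʳ y′∈ _ = irrμ y∈ y′∈ u≢v c
... | onlyʳ _ ¬c  | both x∈ _ d = ¬c x∈ (compatible-sym (compatible-trans c (+ₛ-compatibleˡ d)))
... | both _ y∈ d | onlyˡ _ ¬c  =
  ¬c y∈ (compatible-trans (compatible-sym c) (compatible-trans (+ₛ-compatibleˡ d) d))
... | both x∈ _ d | onlyʳ _ ¬c  =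
  ¬c x∈ (compatible-trans (compatible-sym (+ₛ-compatibleˡ d)) c)
... | both x∈ y∈ d | both x′∈ y′∈ d′ =
  irrγ x∈ x′∈ (λ x≡x′ → irrμ y∈ y′∈ (λ y≡y′ → u≢v (cong₂ _+ₛ_ x≡x′ y≡y′)) y≈y′) x≈x′
  where
    x≈x′ = +ₛ-compatible⇒compatibleˡ d d′ c
    y≈y′ = compatible-trans (compatible-sym d) (compatible-trans x≈x′ d′)

sumTerms-incompatible : (γ μ zs : List (Str k)) → Incompatible γ zs → Incompatible μ zs →
  Incompatible (sumTerms γ μ) zs
sumTerms-incompatible γ μ zs incγ incμ u∈ z∈ c with ∈-sumTerms⁻ γ μ u∈
... | onlyˡ x∈ _  = incγ x∈ z∈ c
... | onlyʳ y∈ _  = incμ y∈ z∈ c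
... | both x∈ _ d = incγ x∈ z∈ (compatible-trans (compatible-sym (+ₛ-compatibleˡ d)) c)

IrT-sumTerms : ∀ {m} (η : V k m) {γ μ : List (Str k)} → IrT η γ → IrT η μ →
  IrT η (sumTerms γ μ)
IrT-sumTerms η {γ} {μ} (irrγ , incγ) (irrμ , incμ) =
  sumTerms-irreducible γ μ irrγ irrμ , sumTerms-incompatible γ μ (terms η) incγ incμ

ιBound : List (Str k) → ℕ
ιBound zs = sum (map (λ z → ∣ ι z ∣) zs)

∣ι∣≤ιBound : {zs : List (Str k)} {z : Str k} → z ∈ zs → ∣ ι z ∣ ≤ ιBound zs
∣ι∣≤ιBound (here refl) = m≤m+n _ _
∣ι∣≤ιBound (there z∈) = ≤-trans (∣ι∣≤ιBound z∈) (m≤n+m _ _)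

avoiding : ∀ {m} → List (Str k) → V k m
avoiding {k} {m} zs = record
  { terms       = fresh ∷ []
  ; nonempty    = λ ()
  ; inΓ         = emptyBlocks k All.∷ All.[]
  ; irreducible = λ { (here refl) (here refl) x≢x _ → x≢x refl }
  }
  where
    fresh : Str k
    fresh = + suc (ιBound zs) , replicate k []
    emptyBlocks : ∀ n → VAll.All (λ w → length w ≤ m) (replicate {A = List ℤ} n [])
    emptyBlocks zero    = VAll.[]
    emptyBlocks (suc n) = z≤n VAll.∷ emptyBlocks n

avoiding-incompatible : ∀ {m} (zs : List (Str k)) → Incompatible (terms (avoiding {m = m} zs)) zs
avoiding-incompatible zs (here refl) z∈ (ι≡ , _) =
  <-irrefl (cong ∣_∣ (sym ι≡)) (s≤s (∣ι∣≤ιBound z∈))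

avoiding-Ir : ∀ {m} (η : V k m) (zs : List (Str k)) → (∀ {z} → z ∈ terms η → z ∈ zs) →
  Ir η (avoiding zs)
avoiding-Ir {m = m} η zs η⊆zs =
  irreducible (avoiding {m = m} zs) , λ x∈ z∈ → avoiding-incompatible {m = m} zs x∈ (η⊆zs z∈)

mainTheorem8 : (k m : ℕ) → 2 ≤ k →
    ((η : V k m) → IsSubsemigroup k m (IrT η))
    × ((n : ℕ) (ηs : Fin (suc n) → V k m) → Σ (V k m) (λ y → ∀ i → Ir (ηs i) y))
    × ((n : ℕ) (ηs : Fin (suc n) → V k m) → IsSubsemigroup k m (IrSetT ηs))
mainTheorem8 k m _ = subsemigroup , finiteIntersection , intersectionSubsemigroup
  where
    subsemigroup : (η : V k m) → IsSubsemigroup k m (IrT η)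
    subsemigroup η = (avoiding (terms η) , avoiding-Ir η (terms η) (λ z∈ → z∈))
                   , λ _ _ → IrT-sumTerms η

    finiteIntersection : (n : ℕ) (ηs : Fin (suc n) → V k m) → Σ (V k m) (λ y → ∀ i → Ir (ηs i) y)
    finiteIntersection n ηs = avoiding allTerms , λ i →
        avoiding-Ir (ηs i) allTerms (λ z∈ → ∈-concatMap⁺ termsOf (lose (∈-allFin i) z∈))
      where
        termsOf : Fin (suc n) → List (Str k)
        termsOf i = terms (ηs i)
        allTerms : List (Str k)
        allTerms = concatMap termsOf (allFin (suc n))

    intersectionSubsemigroup : (n : ℕ) (ηs : Fin (suc n) → V k m) → IsSubsemigroup k m (IrSetT ηs)
    intersectionSubsemigroup n ηs =
      finiteIntersection n ηs , λ _ _ pγ pμ i → IrT-sumTerms (ηs i) (pγ i) (pμ i)
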